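{- Let $(\mathcal{M}_1,\boldsymbol\gamma_1)$ and $(\mathcal{M}_2,\boldsymbol\gamma_2)$ be weighted binary matroids with $E(\mathcal{M}_1)\cap E(\mathcal{M}_2)=\{p\}$, where $p$ is not a loop in either $\mathcal{M}_1$ or $\mathcal{M}_2$. Then there is a weight $d\ge0$ such that, for every weight function $\boldsymbol\delta$ on $\{p,e\}$ with $\delta_e=d$, $$\tilde Z(\mathcal{M}_1\triangle\mathcal{M}_2;\boldsymbol\gamma_1\triangle\boldsymbol\gamma_2)=\lambda\,\tilde Z(\mathcal{M}_1\triangle\mathcal{I}_2;\boldsymbol\gamma_1\triangle\boldsymbol\delta),$$ where $\lambda=2(2+d)^{ -1}\tilde Z(\mathcal{M}_2\backslash p;\boldsymbol\gamma_2)$. The value $d$ can be computed from $\tilde Z(\mathcal{M}_2\backslash p;\boldsymbol\gamma_2)$ and $\tilde Z(\mathcal{M}_2/p;\boldsymbol\gamma_2)$ alone; it does not otherwise depend on $(\mathcal{M}_1,\boldsymbol\gamma_1)$ or $(\mathcal{M}_2,\boldsymbol\gamma_2)$.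
   Context: $\mathcal{I}_2$ is the binary matroid on ground set $\{p,e\}$ in which $\{p,e\}$ is a circuit. Weighted matroids have non-negative weights; $\tilde Z(\mathcal{N};\boldsymbol\gamma)=\sum_{A\subseteq E(\mathcal{N})}\gamma_A2^{ -r_{\mathcal{N}}(A)}$, $\gamma_A=\prod_{e\in A}\gamma_e$. Deletion $\mathcal{M}\backslash p$ and contraction $\mathcal{M}/p$ are the usual matroid minors. A cycle is a disjoint union of circuits; binary matroids are determined by their cycles, which form a $\mathrm{GF}(2)$-space. For binary $\mathcal{M}_1,\mathcal{M}_2$ with $E(\mathcal{M}_1)=E_1\cup T$, $E(\mathcal{M}_2)=E_2\cup T$ ($E_1,E_2,T$ pairwise disjoint), the delta-sum $\mathcal{M}_1\triangle\mathcal{M}_2$ is the binary matroid on $E_1\cup E_2$ whose cycles are the sets $C_1\oplus C_2\subseteq E_1\cup E_2$ with $C_i$ a cycle of $\mathcal{M}_i$ ($\oplus$ = symmetric difference); the weighting $\boldsymbol\gamma_1\triangle\boldsymbol\gamma_2$ agrees with $\boldsymbol\gamma_1$ on $E_1$ and with $\boldsymbol\gamma_2$ on $E_2$.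
   Formalization: The weights γ₁, γ₂ and δ are non-negative rationals rather than non-negative reals, and the weight d is taken in the rationals. -}

module Defs where

open import Data.Bool using (Bool; true; false; _∧_; _∨_; not; _xor_; if_then_else_)
open import Data.Nat as ℕ using (ℕ; zero; suc; _∸_; _⊔_)
open import Data.Fin using (Fin; zero; suc; splitAt)
open import Data.Fin.Subset using (Subset; ∣_∣; ⁅_⁆; ⊥)
open import Data.Vec using (Vec; []; _∷_; zipWith; take; drop; _++_)
open import Data.List as List using (List; []; _∷_)
open import Data.Sum using ([_,_]′)
open import Data.Product using (_×_)
open import Function using (_∘_)
open import Relation.Binary.PropositionalEquality using (_≡_; refl; subst)
open import Data.Rational using (ℚ; 0ℚ; 1ℚ; ½; _+_; _*_; _≤_; _<_; NonZero; >-nonZero; 1/_)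
open import Data.Rational.Properties using (+-mono-<-≤; +-identityʳ)

allSubsets : ∀ n → List (Subset n)
allSubsets zero    = [] ∷ []
allSubsets (suc n) = List.map (false ∷_) (allSubsets n) List.++ List.map (true ∷_) (allSubsets n)

_⊆ᵇ_ : ∀ {n} → Subset n → Subset n → Bool
[] ⊆ᵇ [] = true
(false ∷ a) ⊆ᵇ (_ ∷ b) = a ⊆ᵇ b
(true ∷ a) ⊆ᵇ (x ∷ b) = x ∧ (a ⊆ᵇ b)

nonEmptyᵇ : ∀ {n} → Subset n → Bool
nonEmptyᵇ [] = false
nonEmptyᵇ (x ∷ a) = x ∨ nonEmptyᵇ a

_⊕_ : ∀ {n} → Subset n → Subset n → Subset n
_⊕_ = zipWith _xor_

-- Binary matroids on ground set Fin n, given by their cycle space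

Cycles : ℕ → Set
Cycles n = Subset n → Bool

-- the cycles of a binary matroid form a GF(2)-subspace; conversely every
-- such subspace is the cycle space of a unique binary matroid
record IsBinary {n : ℕ} (c : Cycles n) : Set where
  field
    empty-cycle : c ⊥ ≡ true
    ⊕-closed    : ∀ A B → c A ≡ true → c B ≡ true → c (A ⊕ B) ≡ true

-- independent: contains no circuit, i.e. no nonempty cycle
independentᵇ : ∀ {n} → Cycles n → Subset n → Bool
independentᵇ {n} c I =
  List.foldr _∧_ true (List.map (λ J → not ((J ⊆ᵇ I) ∧ nonEmptyᵇ J ∧ c J)) (allSubsets n))

rank : ∀ {n} → Cycles n → Subset n → ℕ
rank {n} c A =
  List.foldr _⊔_ 0
    (List.map (λ I → if (I ⊆ᵇ A) ∧ independentᵇ c I then ∣ I ∣ else 0)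
              (allSubsets n))

weightProd : ∀ {n} → (Fin n → ℚ) → Subset n → ℚ
weightProd γ [] = 1ℚ
weightProd γ (b ∷ A) = (if b then γ zero else 1ℚ) * weightProd (γ ∘ suc) A

halfPow : ℕ → ℚ
halfPow zero = 1ℚ
halfPow (suc k) = ½ * halfPow k

sumℚ : List ℚ → ℚ
sumℚ = List.foldr _+_ 0ℚ

Zr : ∀ {n} → (Subset n → ℕ) → (Fin n → ℚ) → ℚ
Zr {n} r γ = sumℚ (List.map (λ A → weightProd γ A * halfPow (r A)) (allSubsets n))

Ztilde : ∀ {n} → Cycles n → (Fin n → ℚ) → ℚ
Ztilde c γ = Zr (rank c) γ

NonNegWeights : ∀ {n} → (Fin n → ℚ) → Set
NonNegWeights γ = ∀ i → 0ℚ ≤ γ i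

-- Minors at the element p = zero (via rank functions)

delRank : ∀ {n} → Cycles (suc n) → Subset n → ℕ
delRank c A = rank c (false ∷ A)

conRank : ∀ {n} → Cycles (suc n) → Subset n → ℕ
conRank c A = rank c (true ∷ A) ∸ rank c ⁅ zero ⁆

restrictW : ∀ {n} → (Fin (suc n) → ℚ) → Fin n → ℚ
restrictW γ = γ ∘ suc

-- Delta-sum along T = {p}, where p = zero in both ground sets.
-- Ground set E1 ∪ E2 is Fin (n1 + n2): first n1 elements are E1.
-- Cycles: sets C1 ⊕ C2 ⊆ E1 ∪ E2 with Ci a cycle of Mi, i.e. p ∈ C1 ⇔ p ∈ C2.

deltaSum : ∀ {n₁ n₂} → Cycles (suc n₁) → Cycles (suc n₂) → Cycles (n₁ ℕ.+ n₂)
deltaSum {n₁} c₁ c₂ S =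
  (c₁ (false ∷ take n₁ S) ∧ c₂ (false ∷ drop n₁ S))
  ∨ (c₁ (true ∷ take n₁ S) ∧ c₂ (true ∷ drop n₁ S))

deltaW : ∀ {n₁ n₂} → (Fin (suc n₁) → ℚ) → (Fin (suc n₂) → ℚ) → Fin (n₁ ℕ.+ n₂) → ℚ
deltaW {n₁} γ₁ γ₂ i = [ γ₁ ∘ suc , γ₂ ∘ suc ]′ (splitAt n₁ i)

-- I₂ : binary matroid on {p, e} = Fin 2 (p = zero, e = suc zero) with
-- circuit {p,e}; its cycles are ∅ and {p,e}.

I₂ : Cycles 2
I₂ (a ∷ b ∷ []) = not (a xor b)

2ℚ : ℚ
2ℚ = 1ℚ + 1ℚ

private
  0<2 : 0ℚ < 2ℚ
  0<2 = Data.Rational.*<* (Data.Integer.+<+ (ℕ.s≤s ℕ.z≤n))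
    where import Data.Integer

2+d>0 : ∀ d → 0ℚ ≤ d → 0ℚ < 2ℚ + d
2+d>0 d h = subst (_< 2ℚ + d) (+-identityʳ 0ℚ) (+-mono-<-≤ 0<2 h)

lambda : (d : ℚ) → 0ℚ ≤ d → ℚ → ℚ
lambda d h z = 2ℚ * ((1/ (2ℚ + d)) {{>-nonZero (2+d>0 d h)}}) * z

{-# OPTIONS --safe #-}
-- In a binary matroid the cycles contained in S form a GF(2)-space of dimension
-- ∣S∣ - r(S), so 2^-r(S) = 2^-∣S∣ N(S) with N(S) the number of cycles inside S, and
-- Z̃ = Σ_S γ_S 2^-∣S∣ N(S).  A cycle of M₁ △ M₂ is C₁ ⊕ C₂ with p in both or in
-- neither, so splitting each count by whether the cycle contains p gives
--   Z̃(M₁ △ M₂) = W⁰(M₁) W⁰(M₂) + W¹(M₁) W¹(M₂),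
-- where W⁰(M) = Z̃(M \ p) and W⁰(M) + W¹(M) = Z̃(M / p).  For I₂ with δ_e = d these
-- are 1 + d/2 and d/2, so M₂ may be replaced by I₂ as soon as d (W⁰ - W¹) = 2 W¹.
-- Such a d ≥ 0 exists because W⁰ - W¹ ≥ 1: inside any S the cycles through p are
-- either absent or a translate of those avoiding p, and S = ∅ contributes 1 - 0.
module Submission where

open import Algebra.Bundles using (CommutativeSemiring)

module SubsetSum {c ℓ} (R : CommutativeSemiring c ℓ) where

  open import Data.Bool using (false; true)
  open import Data.Fin.Subset using (Subset)
  open import Data.Nat as ℕ using (zero; suc)
  open import Data.Vec using ([]; _∷_; _++_)
  open import Function using (_∘_)
  open import Defs using (_⊕_)

  open CommutativeSemiring R
  open import Algebra.Properties.CommutativeSemigroup +-commutativeSemigroup using (interchange)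
  open import Relation.Binary.Reasoning.Setoid setoid

  ∑ : ∀ n → (Subset n → Carrier) → Carrier
  ∑ zero    f = f []
  ∑ (suc n) f = ∑ n (f ∘ (false ∷_)) + ∑ n (f ∘ (true ∷_))

  ∑-cong : ∀ n {f g : Subset n → Carrier} → (∀ T → f T ≈ g T) → ∑ n f ≈ ∑ n g
  ∑-cong zero    f≈g = f≈g []
  ∑-cong (suc n) f≈g = +-cong (∑-cong n (f≈g ∘ (false ∷_))) (∑-cong n (f≈g ∘ (true ∷_)))

  ∑-zero : ∀ n → ∑ n (λ _ → 0#) ≈ 0#
  ∑-zero zero    = refl
  ∑-zero (suc n) = trans (+-cong (∑-zero n) (∑-zero n)) (+-identityˡ 0#)

  ∑-distrib-+ : ∀ n (f g : Subset n → Carrier) → ∑ n (λ T → f T + g T) ≈ ∑ n f + ∑ n g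
  ∑-distrib-+ zero    f g = refl
  ∑-distrib-+ (suc n) f g =
    trans (+-cong (∑-distrib-+ n _ _) (∑-distrib-+ n _ _)) (interchange _ _ _ _)

  *-distribˡ-∑ : ∀ n x (f : Subset n → Carrier) → x * ∑ n f ≈ ∑ n (λ T → x * f T)
  *-distribˡ-∑ zero    x f = refl
  *-distribˡ-∑ (suc n) x f = trans (distribˡ x _ _) (+-cong (*-distribˡ-∑ n x _) (*-distribˡ-∑ n x _))

  *-distribʳ-∑ : ∀ n x (f : Subset n → Carrier) → ∑ n f * x ≈ ∑ n (λ T → f T * x)
  *-distribʳ-∑ zero    x f = refl
  *-distribʳ-∑ (suc n) x f = trans (distribʳ x _ _) (+-cong (*-distribʳ-∑ n x _) (*-distribʳ-∑ n x _))

  ∑-⊕ : ∀ n (f : Subset n → Carrier) C → ∑ n (λ T → f (T ⊕ C)) ≈ ∑ n f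
  ∑-⊕ zero    f []          = refl
  ∑-⊕ (suc n) f (false ∷ C) = +-cong (∑-⊕ n (f ∘ (false ∷_)) C) (∑-⊕ n (f ∘ (true ∷_)) C)
  ∑-⊕ (suc n) f (true ∷ C)  =
    trans (+-cong (∑-⊕ n (f ∘ (true ∷_)) C) (∑-⊕ n (f ∘ (false ∷_)) C)) (+-comm _ _)

  ∑-++ : ∀ n₁ n₂ (f : Subset (n₁ ℕ.+ n₂) → Carrier) →
         ∑ (n₁ ℕ.+ n₂) f ≈ ∑ n₁ (λ S₁ → ∑ n₂ (λ S₂ → f (S₁ ++ S₂)))
  ∑-++ zero     n₂ f = refl
  ∑-++ (suc n₁) n₂ f = +-cong (∑-++ n₁ n₂ _) (∑-++ n₁ n₂ _)

  ∑∑-* : ∀ n₁ n₂ (f : Subset n₁ → Carrier) (g : Subset n₂ → Carrier) →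
         ∑ n₁ (λ S₁ → ∑ n₂ (λ S₂ → f S₁ * g S₂)) ≈ ∑ n₁ f * ∑ n₂ g
  ∑∑-* n₁ n₂ f g = begin
    ∑ n₁ (λ S₁ → ∑ n₂ (λ S₂ → f S₁ * g S₂)) ≈⟨ ∑-cong n₁ (λ S₁ → sym (*-distribˡ-∑ n₂ (f S₁) g)) ⟩
    ∑ n₁ (λ S₁ → f S₁ * ∑ n₂ g)             ≈⟨ sym (*-distribʳ-∑ n₁ (∑ n₂ g) f) ⟩
    ∑ n₁ f * ∑ n₂ g                         ∎

open import Defs
open import Data.Nat using (ℕ; suc)
open import Data.Fin using (Fin; zero; suc)
open import Data.Fin.Subset using (⁅_⁆)
open import Data.Bool using (false)
open import Data.Product using (Σ; _×_)
open import Relation.Binary.PropositionalEquality using (_≡_)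
open import Data.Rational using (ℚ; 0ℚ; _≤_; _*_)

open import Algebra.Bundles using (CommutativeRing)
import Algebra.Properties.Semiring.Mult as SemiringMult
open import Data.Bool using (Bool; true; _∧_; _∨_; not; _xor_; if_then_else_)
import Data.Bool as Bool
open import Data.Bool.Properties
  using (∧-conicalˡ; ∧-conicalʳ; ∧-assoc; ∨-zeroʳ; xor-same; xor-assoc; xor-identityʳ; not-injective; ¬-not)
open import Data.Fin using (_↑ˡ_; _↑ʳ_)
open import Data.Fin.Properties using (splitAt-↑ˡ; splitAt-↑ʳ)
open import Data.Fin.Subset using (Subset; ∣_∣; ⊥)
open import Data.Fin.Subset.Properties using (anySubset?; ∣⊥∣≡0; ∣⁅x⁆∣≡1)
open import Data.List using ([]; _∷_)
open import Data.Bool.ListAction using (all)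
import Data.List as List
open import Data.List.Properties using (map-++; map-∘)
open import Data.List.Membership.Propositional using (_∈_)
open import Data.List.Membership.Propositional.Properties using (∈-map⁺; ∈-++⁺ˡ; ∈-++⁺ʳ)
open import Data.List.Relation.Unary.Any using (here; there)
import Data.Nat as ℕ
import Data.Nat.Properties as ℕₚ
open import Data.Product using (_,_; ∃)
open import Data.Rational using (1ℚ; ½; _+_; _-_; _<_; 1/_)
import Data.Rational as ℚ
import Data.Rational.Properties as ℚₚ
open import Data.Sum using ([_,_]′)
open import Data.Vec using (Vec; []; _∷_; _++_; take; drop)
open import Data.Vec.Properties using (take-zipWith; drop-zipWith; take++drop≡id; ++-injectiveˡ; ++-injectiveʳ)
open import Function using (_∘_)
open import Relation.Binary.PropositionalEquality using (refl; sym; trans; cong; cong₂; subst; module ≡-Reasoning)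
open import Relation.Nullary using (¬_; Dec; yes; no; dec⇒maybe; contradiction)
open import Tactic.RingSolver using (solve-∀)
open import Tactic.RingSolver.Core.AlmostCommutativeRing using (AlmostCommutativeRing; fromCommutativeRing)
import Data.Nat.Tactic.RingSolver as ℕ-Solver

⊆ᵇ-trans : ∀ {n} (A B C : Subset n) → A ⊆ᵇ B ≡ true → B ⊆ᵇ C ≡ true → A ⊆ᵇ C ≡ true
⊆ᵇ-trans []          []          []          _   _   = refl
⊆ᵇ-trans (false ∷ A) (false ∷ B) (_ ∷ C)     A⊆B B⊆C = ⊆ᵇ-trans A B C A⊆B B⊆C
⊆ᵇ-trans (false ∷ A) (true ∷ B)  (c ∷ C)     A⊆B B⊆C = ⊆ᵇ-trans A B C A⊆B (∧-conicalʳ c _ B⊆C)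
⊆ᵇ-trans (true ∷ A)  (true ∷ B)  (true ∷ C)  A⊆B B⊆C = ⊆ᵇ-trans A B C A⊆B B⊆C
⊆ᵇ-trans (true ∷ A)  (false ∷ B) _           ()  _
⊆ᵇ-trans (true ∷ A)  (true ∷ B)  (false ∷ C) _   ()

⊥⊆ᵇ : ∀ {n} (A : Subset n) → ⊥ ⊆ᵇ A ≡ true
⊥⊆ᵇ []      = refl
⊥⊆ᵇ (_ ∷ A) = ⊥⊆ᵇ A

⊆ᵇ⊥ : ∀ {n} (A : Subset n) → A ⊆ᵇ ⊥ ≡ true → A ≡ ⊥
⊆ᵇ⊥ []          _   = refl
⊆ᵇ⊥ (false ∷ A) A⊆⊥ = cong (false ∷_) (⊆ᵇ⊥ A A⊆⊥)
⊆ᵇ⊥ (true ∷ A)  ()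

nonEmptyᵇ-⊥ : ∀ n → nonEmptyᵇ (⊥ {n}) ≡ false
nonEmptyᵇ-⊥ ℕ.zero  = refl
nonEmptyᵇ-⊥ (suc n) = nonEmptyᵇ-⊥ n

⊆ᵇ-⊕ : ∀ {n} (T C S : Subset n) → C ⊆ᵇ S ≡ true → (T ⊕ C) ⊆ᵇ S ≡ T ⊆ᵇ S
⊆ᵇ-⊕ []          []          []          _   = refl
⊆ᵇ-⊕ (false ∷ T) (false ∷ C) (_ ∷ S)     C⊆S = ⊆ᵇ-⊕ T C S C⊆S
⊆ᵇ-⊕ (true ∷ T)  (false ∷ C) (s ∷ S)     C⊆S = cong (s ∧_) (⊆ᵇ-⊕ T C S C⊆S)
⊆ᵇ-⊕ (false ∷ T) (true ∷ C)  (true ∷ S)  C⊆S = ⊆ᵇ-⊕ T C S C⊆S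
⊆ᵇ-⊕ (true ∷ T)  (true ∷ C)  (true ∷ S)  C⊆S = ⊆ᵇ-⊕ T C S C⊆S
⊆ᵇ-⊕ (_ ∷ T)     (true ∷ C)  (false ∷ S) ()

⊆ᵇ-++ : ∀ {n₁ n₂} (T₁ S₁ : Subset n₁) (T₂ S₂ : Subset n₂) →
        (T₁ ++ T₂) ⊆ᵇ (S₁ ++ S₂) ≡ T₁ ⊆ᵇ S₁ ∧ T₂ ⊆ᵇ S₂
⊆ᵇ-++ []           []       T₂ S₂ = refl
⊆ᵇ-++ (false ∷ T₁) (_ ∷ S₁) T₂ S₂ = ⊆ᵇ-++ T₁ S₁ T₂ S₂
⊆ᵇ-++ (true ∷ T₁)  (s ∷ S₁) T₂ S₂ = trans (cong (s ∧_) (⊆ᵇ-++ T₁ S₁ T₂ S₂)) (sym (∧-assoc s _ _))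

⊕-self : ∀ {n} (T : Subset n) → T ⊕ T ≡ ⊥
⊕-self []      = refl
⊕-self (t ∷ T) = cong₂ _∷_ (xor-same t) (⊕-self T)

⊕-cancelʳ : ∀ {n} (T C : Subset n) → (T ⊕ C) ⊕ C ≡ T
⊕-cancelʳ []      []      = refl
⊕-cancelʳ (t ∷ T) (c ∷ C) =
  cong₂ _∷_ (trans (xor-assoc t c c) (trans (cong (t xor_) (xor-same c)) (xor-identityʳ t)))
            (⊕-cancelʳ T C)

⊥-++ : ∀ m {n} → ⊥ {m ℕ.+ n} ≡ ⊥ {m} ++ ⊥ {n}
⊥-++ ℕ.zero  = refl
⊥-++ (suc m) = cong (false ∷_) (⊥-++ m)

∣++∣ : ∀ {n₁ n₂} (S₁ : Subset n₁) (S₂ : Subset n₂) → ∣ S₁ ++ S₂ ∣ ≡ ∣ S₁ ∣ ℕ.+ ∣ S₂ ∣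
∣++∣ []           S₂ = refl
∣++∣ (false ∷ S₁) S₂ = ∣++∣ S₁ S₂
∣++∣ (true ∷ S₁)  S₂ = cong suc (∣++∣ S₁ S₂)

take-++ : ∀ {a} {A : Set a} m {n} (xs : Vec A m) (ys : Vec A n) → take m (xs ++ ys) ≡ xs
take-++ m xs ys = ++-injectiveˡ (take m (xs ++ ys)) xs (take++drop≡id m (xs ++ ys))

drop-++ : ∀ {a} {A : Set a} m {n} (xs : Vec A m) (ys : Vec A n) → drop m (xs ++ ys) ≡ ys
drop-++ m xs ys = ++-injectiveʳ (take m (xs ++ ys)) xs (take++drop≡id m (xs ++ ys))

module ℕ∑ = SubsetSum ℕₚ.+-*-commutativeSemiring
module ℚ∑ = SubsetSum (CommutativeRing.commutativeSemiring ℚₚ.+-*-commutativeRing)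

all-true⁺ : ∀ {a} {A : Set a} (p : A → Bool) xs → (∀ x → p x ≡ true) → all p xs ≡ true
all-true⁺ p []       p≡true = refl
all-true⁺ p (x ∷ xs) p≡true rewrite p≡true x = all-true⁺ p xs p≡true

all-true⁻ : ∀ {a} {A : Set a} (p : A → Bool) {xs x} → all p xs ≡ true → x ∈ xs → p x ≡ true
all-true⁻ p {y ∷ _} all≡true (here refl)  = ∧-conicalˡ (p y) _ all≡true
all-true⁻ p {y ∷ _} all≡true (there x∈xs) = all-true⁻ p (∧-conicalʳ (p y) _ all≡true) x∈xs

foldr-⊔-lub : ∀ {a} {A : Set a} (f : A → ℕ) xs {m} → (∀ x → f x ℕ.≤ m) →
              List.foldr ℕ._⊔_ 0 (List.map f xs) ℕ.≤ m
foldr-⊔-lub f []       f≤m = ℕ.z≤n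
foldr-⊔-lub f (x ∷ xs) f≤m = ℕₚ.⊔-lub (f≤m x) (foldr-⊔-lub f xs f≤m)

foldr-⊔-ub : ∀ {a} {A : Set a} (f : A → ℕ) {xs x} → x ∈ xs →
             f x ℕ.≤ List.foldr ℕ._⊔_ 0 (List.map f xs)
foldr-⊔-ub f {y ∷ _} (here refl)  = ℕₚ.m≤m⊔n (f y) _
foldr-⊔-ub f {y ∷ _} (there x∈xs) = ℕₚ.≤-trans (foldr-⊔-ub f x∈xs) (ℕₚ.m≤n⊔m (f y) _)

∈-allSubsets : ∀ {n} (S : Subset n) → S ∈ allSubsets n
∈-allSubsets []          = here refl
∈-allSubsets (false ∷ S) = ∈-++⁺ˡ (∈-map⁺ (false ∷_) (∈-allSubsets S))
∈-allSubsets {suc n} (true ∷ S) =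
  ∈-++⁺ʳ (List.map (false ∷_) (allSubsets n)) (∈-map⁺ (true ∷_) (∈-allSubsets S))

sumℚ-++ : ∀ xs ys → sumℚ (xs List.++ ys) ≡ sumℚ xs + sumℚ ys
sumℚ-++ []       ys = sym (ℚₚ.+-identityˡ (sumℚ ys))
sumℚ-++ (x ∷ xs) ys = trans (cong (x +_) (sumℚ-++ xs ys)) (sym (ℚₚ.+-assoc x (sumℚ xs) (sumℚ ys)))

sumℚ-allSubsets : ∀ n (f : Subset n → ℚ) → sumℚ (List.map f (allSubsets n)) ≡ ℚ∑.∑ n f
sumℚ-allSubsets ℕ.zero  f = ℚₚ.+-identityʳ (f [])
sumℚ-allSubsets (suc n) f = begin
  sumℚ (List.map f (List.map (false ∷_) A List.++ List.map (true ∷_) A))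
    ≡⟨ cong sumℚ (map-++ f (List.map (false ∷_) A) _) ⟩
  sumℚ (List.map f (List.map (false ∷_) A) List.++ List.map f (List.map (true ∷_) A))
    ≡⟨ sumℚ-++ (List.map f (List.map (false ∷_) A)) _ ⟩
  sumℚ (List.map f (List.map (false ∷_) A)) + sumℚ (List.map f (List.map (true ∷_) A))
    ≡⟨ cong₂ _+_ (trans (cong sumℚ (sym (map-∘ A))) (sumℚ-allSubsets n _))
                 (trans (cong sumℚ (sym (map-∘ A))) (sumℚ-allSubsets n _)) ⟩
  ℚ∑.∑ (suc n) f ∎
  where
  open ≡-Reasoning
  A = allSubsets n

-- Counting cycles

𝟙 : Bool → ℕ
𝟙 false = 0
𝟙 true  = 1

cyclesIn : ∀ {n} → Cycles n → Subset n → ℕ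
cyclesIn {n} c S = ℕ∑.∑ n (λ T → 𝟙 (T ⊆ᵇ S ∧ c T))

-- fiber false c is the cycle space of M \ p and contraction c that of M / p,
-- for p = zero; fiber true c consists of the sets C with C ∪ {p} a cycle.
fiber : ∀ {n} → Bool → Cycles (suc n) → Cycles n
fiber b c T = c (b ∷ T)

contraction : ∀ {n} → Cycles (suc n) → Cycles n
contraction c T = c (false ∷ T) ∨ c (true ∷ T)

cyclesIn-⊥ : ∀ {n} (c : Cycles n) → cyclesIn c ⊥ ≡ 𝟙 (c ⊥)
cyclesIn-⊥ {ℕ.zero} c = refl
cyclesIn-⊥ {suc n}  c =
  trans (cong₂ ℕ._+_ (cyclesIn-⊥ (fiber false c)) (ℕ∑.∑-zero n)) (ℕₚ.+-identityʳ _)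

cyclesIn-false∷ : ∀ {n} (c : Cycles (suc n)) S → cyclesIn c (false ∷ S) ≡ cyclesIn (fiber false c) S
cyclesIn-false∷ {n} c S = trans (cong (cyclesIn (fiber false c) S ℕ.+_) (ℕ∑.∑-zero n)) (ℕₚ.+-identityʳ _)

open IsBinary

fiber-binary : ∀ {n} {c : Cycles (suc n)} → IsBinary c → IsBinary (fiber false c)
fiber-binary bin = record
  { empty-cycle = empty-cycle bin
  ; ⊕-closed    = λ A B → ⊕-closed bin (false ∷ A) (false ∷ B)
  }

contraction-intro : ∀ {n} (c : Cycles (suc n)) b {T} → c (b ∷ T) ≡ true → contraction c T ≡ true
contraction-intro c false {T} c[b∷T] rewrite c[b∷T] = refl
contraction-intro c true  {T} c[b∷T] rewrite c[b∷T] = ∨-zeroʳ (c (false ∷ T))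

contraction-elim : ∀ {n} (c : Cycles (suc n)) {T} → contraction c T ≡ true → ∃ λ b → c (b ∷ T) ≡ true
contraction-elim c {T} h with c (false ∷ T) in c[p∉T]
... | true  = false , c[p∉T]
... | false = true , h

contraction-binary : ∀ {n} {c : Cycles (suc n)} → IsBinary c → IsBinary (contraction c)
contraction-binary {c = c} bin = record
  { empty-cycle = contraction-intro c false (empty-cycle bin)
  ; ⊕-closed    = closed
  }
  where
  closed : ∀ A B → contraction c A ≡ true → contraction c B ≡ true → contraction c (A ⊕ B) ≡ true
  closed A B cA cB with contraction-elim c cA | contraction-elim c cB
  ... | a , c[a∷A] | b , c[b∷B] = contraction-intro c (a xor b) (⊕-closed bin (a ∷ A) (b ∷ B) c[a∷A] c[b∷B])

fibers-disjoint : ∀ {n} {c : Cycles (suc n)} → IsBinary c → c ⁅ zero ⁆ ≡ false →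
                  ∀ T → fiber false c T ∧ fiber true c T ≡ false
fibers-disjoint {c = c} bin nonloop T with c (false ∷ T) in c[T] | c (true ∷ T) in c[p∷T]
... | false | _     = refl
... | true  | false = refl
... | true  | true  = trans (sym p-cycle) nonloop
  where
  p-cycle : c ⁅ zero ⁆ ≡ true
  p-cycle = subst (λ X → c (true ∷ X) ≡ true) (⊕-self T) (⊕-closed bin (false ∷ T) (true ∷ T) c[T] c[p∷T])

𝟙-∧-∨ : ∀ a x y → x ∧ y ≡ false → 𝟙 (a ∧ (x ∨ y)) ≡ 𝟙 (a ∧ x) ℕ.+ 𝟙 (a ∧ y)
𝟙-∧-∨ false x     y     _ = refl
𝟙-∧-∨ true  false y     _ = refl
𝟙-∧-∨ true  true  false _ = refl

cyclesIn-contraction : ∀ {n} {c : Cycles (suc n)} → IsBinary c → c ⁅ zero ⁆ ≡ false → ∀ S →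
                       cyclesIn (contraction c) S ≡ cyclesIn (fiber false c) S ℕ.+ cyclesIn (fiber true c) S
cyclesIn-contraction {n} bin nonloop S =
  trans (ℕ∑.∑-cong n (λ T → 𝟙-∧-∨ (T ⊆ᵇ S) _ _ (fibers-disjoint bin nonloop T))) (ℕ∑.∑-distrib-+ n _ _)

true-ext : ∀ {a b} → (a ≡ true → b ≡ true) → (b ≡ true → a ≡ true) → a ≡ b
true-ext {false} {false} _   _   = refl
true-ext {false} {true}  _   b⇒a = b⇒a refl
true-ext {true}  {false} a⇒b _   = sym (a⇒b refl)
true-ext {true}  {true}  _   _   = refl

cycle-translate : ∀ {n} {c : Cycles n} → IsBinary c → ∀ {C} → c C ≡ true → ∀ T → c (T ⊕ C) ≡ c T
cycle-translate {c = c} bin {C} cC T = true-ext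
  (λ c[T⊕C] → subst (λ X → c X ≡ true) (⊕-cancelʳ T C) (⊕-closed bin (T ⊕ C) C c[T⊕C] cC))
  (λ cT → ⊕-closed bin T C cT cC)

ThroughCycleIn : ∀ {n} → Cycles (suc n) → Subset n → Set
ThroughCycleIn c S = ∃ λ C → C ⊆ᵇ S ∧ c (true ∷ C) ≡ true

throughCycleIn? : ∀ {n} (c : Cycles (suc n)) S → Dec (ThroughCycleIn c S)
throughCycleIn? c S = anySubset? (λ C → C ⊆ᵇ S ∧ c (true ∷ C) Bool.≟ true)

-- Translation by a cycle through p exchanges the two fibers.
cyclesIn-fiber-true≡false : ∀ {n} {c : Cycles (suc n)} → IsBinary c → ∀ S → ThroughCycleIn c S →
                            cyclesIn (fiber true c) S ≡ cyclesIn (fiber false c) S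
cyclesIn-fiber-true≡false {n} {c} bin S (C , C∈S) = begin
  ℕ∑.∑ n (λ T → 𝟙 (T ⊆ᵇ S ∧ c (true ∷ T)))
    ≡⟨ ℕ∑.∑-cong n (λ T → sym (cong₂ (λ x y → 𝟙 (x ∧ y)) (⊆ᵇ-⊕ T C S C⊆S) (cycle-translate bin cC (true ∷ T)))) ⟩
  ℕ∑.∑ n (λ T → 𝟙 ((T ⊕ C) ⊆ᵇ S ∧ c (false ∷ (T ⊕ C))))
    ≡⟨ ℕ∑.∑-⊕ n (λ T → 𝟙 (T ⊆ᵇ S ∧ c (false ∷ T))) C ⟩
  cyclesIn (fiber false c) S ∎
  where
  open ≡-Reasoning
  C⊆S : C ⊆ᵇ S ≡ true
  C⊆S = ∧-conicalˡ _ _ C∈S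
  cC : c (true ∷ C) ≡ true
  cC = ∧-conicalʳ _ _ C∈S

cyclesIn-fiber-true≡0 : ∀ {n} {c : Cycles (suc n)} S → ¬ ThroughCycleIn c S → cyclesIn (fiber true c) S ≡ 0
cyclesIn-fiber-true≡0 {n} S none =
  trans (ℕ∑.∑-cong n (λ C → cong 𝟙 (¬-not (λ C∈S → none (C , C∈S))))) (ℕ∑.∑-zero n)

cyclesIn-fiber-true≤false : ∀ {n} {c : Cycles (suc n)} → IsBinary c → ∀ S →
                            cyclesIn (fiber true c) S ℕ.≤ cyclesIn (fiber false c) S
cyclesIn-fiber-true≤false {c = c} bin S with throughCycleIn? c S
... | yes through = ℕₚ.≤-reflexive (cyclesIn-fiber-true≡false bin S through)
... | no  none    = ℕₚ.≤-trans (ℕₚ.≤-reflexive (cyclesIn-fiber-true≡0 {c = c} S none)) ℕ.z≤n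

-- Independence and rank

Independent : ∀ {n} → Cycles n → Subset n → Set
Independent c I = ∀ J → J ⊆ᵇ I ∧ nonEmptyᵇ J ∧ c J ≡ false

independentᵇ⁺ : ∀ {n} (c : Cycles n) {I} → Independent c I → independentᵇ c I ≡ true
independentᵇ⁺ {n} c indep = all-true⁺ _ (allSubsets n) (λ J → cong not (indep J))

independentᵇ⁻ : ∀ {n} (c : Cycles n) {I} → independentᵇ c I ≡ true → Independent c I
independentᵇ⁻ c {I} indep J =
  not-injective {y = false} (all-true⁻ (λ J → not (J ⊆ᵇ I ∧ nonEmptyᵇ J ∧ c J)) indep (∈-allSubsets J))

[]-independent : (c : Cycles 0) → Independent c []
[]-independent c [] = refl

Independent-fiber⁻ : ∀ {n} {c : Cycles (suc n)} {I} → Independent c (false ∷ I) → Independent (fiber false c) I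
Independent-fiber⁻ indep J = indep (false ∷ J)

Independent-fiber⁺ : ∀ {n} {c : Cycles (suc n)} {I} → Independent (fiber false c) I → Independent c (false ∷ I)
Independent-fiber⁺ indep (false ∷ J) = indep J
Independent-fiber⁺ indep (true ∷ J)  = refl

Independent-contraction : ∀ {n} {c : Cycles (suc n)} {I} → Independent c (true ∷ I) → Independent (contraction c) I
Independent-contraction {I = I} indep J = ∧-∧-∨ (J ⊆ᵇ I) (nonEmptyᵇ J) _ _ (indep (false ∷ J)) (indep (true ∷ J))
  where
  ∧-∧-∨ : ∀ a e x y → a ∧ e ∧ x ≡ false → a ∧ true ∧ y ≡ false → a ∧ e ∧ (x ∨ y) ≡ false
  ∧-∧-∨ false e     x     y     _ _ = refl
  ∧-∧-∨ true  false x     y     _ _ = refl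
  ∧-∧-∨ true  true  false false _ _ = refl

Independent⇒nonloop : ∀ {n} {c : Cycles (suc n)} {I} → Independent c (true ∷ I) → c ⁅ zero ⁆ ≡ false
Independent⇒nonloop {c = c} {I} indep = subst (λ x → x ∧ true ∧ c ⁅ zero ⁆ ≡ false) (⊥⊆ᵇ I) (indep (true ∷ ⊥))

Independent-extend : ∀ {n} {c : Cycles (suc n)} {I S} → Independent (fiber false c) I → I ⊆ᵇ S ≡ true →
                     ¬ ThroughCycleIn c S → Independent c (true ∷ I)
Independent-extend indep I⊆S none (false ∷ J) = indep J
Independent-extend {c = c} {I} {S} indep I⊆S none (true ∷ J) with J ⊆ᵇ I in J⊆I
... | false = refl
... | true  = ¬-not λ cJ → none (J , subst (λ x → x ∧ c (true ∷ J) ≡ true) (sym (⊆ᵇ-trans J I S J⊆I I⊆S)) cJ)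

Independent-⁅p⁆ : ∀ {n} {c : Cycles (suc n)} → c ⁅ zero ⁆ ≡ false → Independent c ⁅ zero ⁆
Independent-⁅p⁆ {n} nonloop (false ∷ J) with J ⊆ᵇ ⊥ in J⊆⊥
... | false = refl
... | true rewrite ⊆ᵇ⊥ J J⊆⊥ | nonEmptyᵇ-⊥ n = refl
Independent-⁅p⁆ nonloop (true ∷ J) with J ⊆ᵇ ⊥ in J⊆⊥
... | false = refl
... | true rewrite ⊆ᵇ⊥ J J⊆⊥ = nonloop

2^-reflects-≤ : ∀ {a b} → 2 ℕ.^ a ℕ.≤ 2 ℕ.^ b → a ℕ.≤ b
2^-reflects-≤ 2^a≤2^b = ℕₚ.≮⇒≥ (λ b<a → ℕₚ.<⇒≱ (ℕₚ.^-monoʳ-< 2 (ℕₚ.n<1+n 1) b<a) 2^a≤2^b)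

[a+a]*x≡2*[a*x] : ∀ a x → (a ℕ.+ a) ℕ.* x ≡ 2 ℕ.* (a ℕ.* x)
[a+a]*x≡2*[a*x] = ℕ-Solver.solve-∀

a*[2*x]≡2*[a*x] : ∀ a x → a ℕ.* (2 ℕ.* x) ≡ 2 ℕ.* (a ℕ.* x)
a*[2*x]≡2*[a*x] = ℕ-Solver.solve-∀

cyclesIn*2^∣I∣≤2^∣S∣ : ∀ {n} {c : Cycles n} → IsBinary c → ∀ S I → I ⊆ᵇ S ≡ true → Independent c I →
                       cyclesIn c S ℕ.* 2 ℕ.^ ∣ I ∣ ℕ.≤ 2 ℕ.^ ∣ S ∣
cyclesIn*2^∣I∣≤2^∣S∣ bin [] [] _ _ = ℕₚ.≤-reflexive (cong (λ b → 𝟙 b ℕ.* 1) (empty-cycle bin))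
cyclesIn*2^∣I∣≤2^∣S∣ {c = c} bin (false ∷ S) (false ∷ I) I⊆S indep =
  subst (λ N → N ℕ.* 2 ℕ.^ ∣ I ∣ ℕ.≤ 2 ℕ.^ ∣ S ∣) (sym (cyclesIn-false∷ c S))
        (cyclesIn*2^∣I∣≤2^∣S∣ (fiber-binary bin) S I I⊆S (Independent-fiber⁻ indep))
cyclesIn*2^∣I∣≤2^∣S∣ {c = c} bin (true ∷ S) (false ∷ I) I⊆S indep = begin
  (N⁰ ℕ.+ N¹) ℕ.* 2 ℕ.^ ∣ I ∣
    ≤⟨ ℕₚ.*-monoˡ-≤ _ (ℕₚ.+-monoʳ-≤ N⁰ (cyclesIn-fiber-true≤false bin S)) ⟩
  (N⁰ ℕ.+ N⁰) ℕ.* 2 ℕ.^ ∣ I ∣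
    ≡⟨ [a+a]*x≡2*[a*x] N⁰ _ ⟩
  2 ℕ.* (N⁰ ℕ.* 2 ℕ.^ ∣ I ∣)
    ≤⟨ ℕₚ.*-monoʳ-≤ 2 (cyclesIn*2^∣I∣≤2^∣S∣ (fiber-binary bin) S I I⊆S (Independent-fiber⁻ indep)) ⟩
  2 ℕ.* 2 ℕ.^ ∣ S ∣ ∎
  where
  open ℕₚ.≤-Reasoning
  N⁰ = cyclesIn (fiber false c) S
  N¹ = cyclesIn (fiber true c) S
cyclesIn*2^∣I∣≤2^∣S∣ {c = c} bin (true ∷ S) (true ∷ I) I⊆S indep = begin
  cyclesIn c (true ∷ S) ℕ.* (2 ℕ.* 2 ℕ.^ ∣ I ∣)
    ≡⟨ cong (ℕ._* _) (cyclesIn-contraction bin (Independent⇒nonloop indep) S) ⟨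
  Ncon ℕ.* (2 ℕ.* 2 ℕ.^ ∣ I ∣)
    ≡⟨ a*[2*x]≡2*[a*x] Ncon _ ⟩
  2 ℕ.* (Ncon ℕ.* 2 ℕ.^ ∣ I ∣)
    ≤⟨ ℕₚ.*-monoʳ-≤ 2 (cyclesIn*2^∣I∣≤2^∣S∣ (contraction-binary bin) S I I⊆S (Independent-contraction indep)) ⟩
  2 ℕ.* 2 ℕ.^ ∣ S ∣ ∎
  where
  open ℕₚ.≤-Reasoning
  Ncon = cyclesIn (contraction c) S

-- Extend a basis of S in M \ p: if some cycle through p lies in S ∪ {p}, then p is
-- spanned and the two fibers have the same size; otherwise p can be added.
basis : ∀ {n} {c : Cycles n} → IsBinary c → ∀ S →
        ∃ λ I → I ⊆ᵇ S ≡ true × Independent c I × cyclesIn c S ℕ.* 2 ℕ.^ ∣ I ∣ ≡ 2 ℕ.^ ∣ S ∣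
basis {c = c} bin [] = [] , refl , []-independent c , cong (λ b → 𝟙 b ℕ.* 1) (empty-cycle bin)
basis {c = c} bin (false ∷ S) with basis (fiber-binary bin) S
... | I , I⊆S , indep , count =
  false ∷ I , I⊆S , Independent-fiber⁺ indep , trans (cong (ℕ._* _) (cyclesIn-false∷ c S)) count
basis {c = c} bin (true ∷ S) with basis (fiber-binary bin) S | throughCycleIn? c S
... | I , I⊆S , indep , count | yes through = false ∷ I , I⊆S , Independent-fiber⁺ indep , (begin
  (N⁰ ℕ.+ N¹) ℕ.* 2 ℕ.^ ∣ I ∣ ≡⟨ cong (λ k → (N⁰ ℕ.+ k) ℕ.* _) (cyclesIn-fiber-true≡false bin S through) ⟩
  (N⁰ ℕ.+ N⁰) ℕ.* 2 ℕ.^ ∣ I ∣ ≡⟨ [a+a]*x≡2*[a*x] N⁰ _ ⟩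
  2 ℕ.* (N⁰ ℕ.* 2 ℕ.^ ∣ I ∣)  ≡⟨ cong (2 ℕ.*_) count ⟩
  2 ℕ.* 2 ℕ.^ ∣ S ∣           ∎)
  where
  open ≡-Reasoning
  N⁰ = cyclesIn (fiber false c) S
  N¹ = cyclesIn (fiber true c) S
... | I , I⊆S , indep , count | no none = true ∷ I , I⊆S , Independent-extend indep I⊆S none , (begin
  (N⁰ ℕ.+ N¹) ℕ.* (2 ℕ.* 2 ℕ.^ ∣ I ∣) ≡⟨ cong (λ k → (N⁰ ℕ.+ k) ℕ.* _) (cyclesIn-fiber-true≡0 {c = c} S none) ⟩
  (N⁰ ℕ.+ 0) ℕ.* (2 ℕ.* 2 ℕ.^ ∣ I ∣)  ≡⟨ cong (ℕ._* _) (ℕₚ.+-identityʳ N⁰) ⟩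
  N⁰ ℕ.* (2 ℕ.* 2 ℕ.^ ∣ I ∣)           ≡⟨ a*[2*x]≡2*[a*x] N⁰ _ ⟩
  2 ℕ.* (N⁰ ℕ.* 2 ℕ.^ ∣ I ∣)           ≡⟨ cong (2 ℕ.*_) count ⟩
  2 ℕ.* 2 ℕ.^ ∣ S ∣                     ∎)
  where
  open ≡-Reasoning
  N⁰ = cyclesIn (fiber false c) S
  N¹ = cyclesIn (fiber true c) S

∣I∣≤rank : ∀ {n} (c : Cycles n) {S I} → I ⊆ᵇ S ≡ true → independentᵇ c I ≡ true → ∣ I ∣ ℕ.≤ rank c S
∣I∣≤rank c {S} {I} I⊆S indep =
  subst (ℕ._≤ rank c S) (cong (λ b → if b then ∣ I ∣ else 0) (cong₂ _∧_ I⊆S indep))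
        (foldr-⊔-ub (λ J → if J ⊆ᵇ S ∧ independentᵇ c J then ∣ J ∣ else 0) (∈-allSubsets I))

rank≤ : ∀ {n} (c : Cycles n) {S m} → (∀ J → J ⊆ᵇ S ≡ true → independentᵇ c J ≡ true → ∣ J ∣ ℕ.≤ m) →
        rank c S ℕ.≤ m
rank≤ {n} c {S} bound = foldr-⊔-lub _ (allSubsets n) candidate≤
  where
  candidate≤ : ∀ J → (if J ⊆ᵇ S ∧ independentᵇ c J then ∣ J ∣ else 0) ℕ.≤ _
  candidate≤ J with J ⊆ᵇ S in J⊆S | independentᵇ c J in indep
  ... | false | _     = ℕ.z≤n
  ... | true  | false = ℕ.z≤n
  ... | true  | true  = bound J J⊆S indep

cyclesIn*2^rank : ∀ {n} {c : Cycles n} → IsBinary c → ∀ S → cyclesIn c S ℕ.* 2 ℕ.^ rank c S ≡ 2 ℕ.^ ∣ S ∣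
cyclesIn*2^rank {c = c} bin S with basis bin S
... | I , I⊆S , indep , count = subst (λ r → cyclesIn c S ℕ.* 2 ℕ.^ r ≡ 2 ℕ.^ ∣ S ∣) ∣I∣≡rank count
  where
  instance
    cyclesIn≢0 : ℕ.NonZero (cyclesIn c S)
    cyclesIn≢0 = ℕ.≢-nonZero λ N≡0 →
      ℕₚ.<⇒≢ (ℕₚ.m^n>0 2 ∣ S ∣) (trans (cong (ℕ._* 2 ℕ.^ ∣ I ∣) (sym N≡0)) count)
  maximal : ∀ J → J ⊆ᵇ S ≡ true → independentᵇ c J ≡ true → ∣ J ∣ ℕ.≤ ∣ I ∣
  maximal J J⊆S indepJ = 2^-reflects-≤ (ℕₚ.*-cancelˡ-≤ (cyclesIn c S)
    (ℕₚ.≤-trans (cyclesIn*2^∣I∣≤2^∣S∣ bin S J J⊆S (independentᵇ⁻ c indepJ)) (ℕₚ.≤-reflexive (sym count))))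
  ∣I∣≡rank : ∣ I ∣ ≡ rank c S
  ∣I∣≡rank = ℕₚ.≤-antisym (∣I∣≤rank c I⊆S (independentᵇ⁺ c indep)) (rank≤ c maximal)

-- Weighted sums over subsets

ℚ-ring : AlmostCommutativeRing _ _
ℚ-ring = fromCommutativeRing ℚₚ.+-*-commutativeRing (λ x → dec⇒maybe (0ℚ ℚₚ.≟ x))

*-nonneg : ∀ {p q} → 0ℚ ≤ p → 0ℚ ≤ q → 0ℚ ≤ p * q
*-nonneg {p} {q} 0≤p 0≤q =
  ℚₚ.nonNegative⁻¹ _ {{ℚₚ.nonNeg*nonNeg⇒nonNeg p {{ℚ.nonNegative 0≤p}} q {{ℚ.nonNegative 0≤q}}}}

+-nonneg : ∀ {p q} → 0ℚ ≤ p → 0ℚ ≤ q → 0ℚ ≤ p + q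
+-nonneg = ℚₚ.+-mono-≤

∑-nonneg : ∀ n (f : Subset n → ℚ) → (∀ T → 0ℚ ≤ f T) → 0ℚ ≤ ℚ∑.∑ n f
∑-nonneg ℕ.zero  f f≥0 = f≥0 []
∑-nonneg (suc n) f f≥0 = +-nonneg (∑-nonneg n _ (f≥0 ∘ (false ∷_))) (∑-nonneg n _ (f≥0 ∘ (true ∷_)))

f⊥≤∑ : ∀ n (f : Subset n → ℚ) → (∀ T → 0ℚ ≤ f T) → f ⊥ ≤ ℚ∑.∑ n f
f⊥≤∑ ℕ.zero  f f≥0 = ℚₚ.≤-refl
f⊥≤∑ (suc n) f f≥0 = subst (_≤ ℚ∑.∑ (suc n) f) (ℚₚ.+-identityʳ (f ⊥))
  (ℚₚ.+-mono-≤ (f⊥≤∑ n _ (f≥0 ∘ (false ∷_))) (∑-nonneg n _ (f≥0 ∘ (true ∷_))))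

module ℚ× = SemiringMult (CommutativeRing.semiring ℚₚ.+-*-commutativeRing)

fromℕ : ℕ → ℚ
fromℕ n = n ℚ×.× 1ℚ

fromℕ-+ : ∀ m n → fromℕ (m ℕ.+ n) ≡ fromℕ m + fromℕ n
fromℕ-+ = ℚ×.×-homo-+ 1ℚ

fromℕ-* : ∀ m n → fromℕ (m ℕ.* n) ≡ fromℕ m * fromℕ n
fromℕ-* = ℚ×.×1-homo-*

fromℕ-nonneg : ∀ n → 0ℚ ≤ fromℕ n
fromℕ-nonneg ℕ.zero  = ℚₚ.≤-refl
fromℕ-nonneg (suc n) = +-nonneg (ℚₚ.<⇒≤ (ℚₚ.positive⁻¹ 1ℚ)) (fromℕ-nonneg n)

halfPow-+ : ∀ a b → halfPow (a ℕ.+ b) ≡ halfPow a * halfPow b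
halfPow-+ ℕ.zero  b = sym (ℚₚ.*-identityˡ (halfPow b))
halfPow-+ (suc a) b = trans (cong (½ *_) (halfPow-+ a b)) (sym (ℚₚ.*-assoc ½ (halfPow a) (halfPow b)))

halfPow*2^ : ∀ k → halfPow k * fromℕ (2 ℕ.^ k) ≡ 1ℚ
halfPow*2^ ℕ.zero  = refl
halfPow*2^ (suc k) = begin
  (½ * halfPow k) * fromℕ (2 ℕ.* 2 ℕ.^ k)       ≡⟨ cong ((½ * halfPow k) *_) (fromℕ-* 2 (2 ℕ.^ k)) ⟩
  (½ * halfPow k) * (fromℕ 2 * fromℕ (2 ℕ.^ k)) ≡⟨ cancel (halfPow k) (fromℕ (2 ℕ.^ k)) ⟩
  halfPow k * fromℕ (2 ℕ.^ k)                   ≡⟨ halfPow*2^ k ⟩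
  1ℚ                                            ∎
  where
  open ≡-Reasoning
  cancel : ∀ a b → (½ * a) * (fromℕ 2 * b) ≡ a * b
  cancel = solve-∀ ℚ-ring

halfPow-nonneg : ∀ k → 0ℚ ≤ halfPow k
halfPow-nonneg ℕ.zero  = ℚₚ.<⇒≤ (ℚₚ.positive⁻¹ 1ℚ)
halfPow-nonneg (suc k) = *-nonneg (ℚₚ.<⇒≤ (ℚₚ.positive⁻¹ ½)) (halfPow-nonneg k)

double-half : ∀ q → 2ℚ * (½ * q) ≡ q
double-half = solve-∀ ℚ-ring

halfPow-pred : ∀ r → 1 ℕ.≤ r → halfPow (r ℕ.∸ 1) ≡ 2ℚ * halfPow r
halfPow-pred (suc r) _ = sym (double-half (halfPow r))

weightProd-cong : ∀ {n} {γ δ : Fin n → ℚ} → (∀ i → γ i ≡ δ i) → ∀ S → weightProd γ S ≡ weightProd δ S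
weightProd-cong γ≡δ []          = refl
weightProd-cong γ≡δ (false ∷ S) = cong (1ℚ *_) (weightProd-cong (γ≡δ ∘ suc) S)
weightProd-cong γ≡δ (true ∷ S)  = cong₂ _*_ (γ≡δ zero) (weightProd-cong (γ≡δ ∘ suc) S)

weightProd-++ : ∀ {n₁ n₂} (γ : Fin (n₁ ℕ.+ n₂) → ℚ) S₁ S₂ →
                weightProd γ (S₁ ++ S₂) ≡ weightProd (γ ∘ (_↑ˡ n₂)) S₁ * weightProd (γ ∘ (n₁ ↑ʳ_)) S₂
weightProd-++ γ []       S₂ = sym (ℚₚ.*-identityˡ _)
weightProd-++ {suc n₁} {n₂} γ (b ∷ S₁) S₂ =
  trans (cong ((if b then γ zero else 1ℚ) *_) (weightProd-++ (γ ∘ suc) S₁ S₂))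
        (sym (ℚₚ.*-assoc (if b then γ zero else 1ℚ) (weightProd (γ ∘ suc ∘ (_↑ˡ n₂)) S₁)
                         (weightProd (γ ∘ suc ∘ (n₁ ↑ʳ_)) S₂)))

weightProd-⊥ : ∀ {n} (γ : Fin n → ℚ) → weightProd γ ⊥ ≡ 1ℚ
weightProd-⊥ {ℕ.zero} γ = refl
weightProd-⊥ {suc n}  γ = trans (ℚₚ.*-identityˡ _) (weightProd-⊥ (γ ∘ suc))

weightProd-nonneg : ∀ {n} {γ : Fin n → ℚ} → NonNegWeights γ → ∀ S → 0ℚ ≤ weightProd γ S
weightProd-nonneg γ≥0 []          = ℚₚ.<⇒≤ (ℚₚ.positive⁻¹ 1ℚ)
weightProd-nonneg γ≥0 (false ∷ S) = *-nonneg (ℚₚ.<⇒≤ (ℚₚ.positive⁻¹ 1ℚ)) (weightProd-nonneg (γ≥0 ∘ suc) S)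
weightProd-nonneg γ≥0 (true ∷ S)  = *-nonneg (γ≥0 zero) (weightProd-nonneg (γ≥0 ∘ suc) S)

Zterm : ∀ {n} → (Subset n → ℕ) → (Fin n → ℚ) → Subset n → ℚ
Zterm N γ S = weightProd γ S * halfPow ∣ S ∣ * fromℕ (N S)

Zcount : ∀ {n} → (Subset n → ℕ) → (Fin n → ℚ) → ℚ
Zcount {n} N γ = ℚ∑.∑ n (Zterm N γ)

Zterm-nonneg : ∀ {n} (N : Subset n → ℕ) {γ : Fin n → ℚ} → NonNegWeights γ → ∀ S → 0ℚ ≤ Zterm N γ S
Zterm-nonneg N γ≥0 S = *-nonneg (*-nonneg (weightProd-nonneg γ≥0 S) (halfPow-nonneg ∣ S ∣)) (fromℕ-nonneg (N S))

Zr≡Zcount : ∀ {n} (r N : Subset n → ℕ) (γ : Fin n → ℚ) →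
            (∀ S → halfPow (r S) ≡ halfPow ∣ S ∣ * fromℕ (N S)) → Zr r γ ≡ Zcount N γ
Zr≡Zcount {n} r N γ halfPow-r = trans (sumℚ-allSubsets n _)
  (ℚ∑.∑-cong n (λ S → trans (cong (weightProd γ S *_) (halfPow-r S))
                             (sym (ℚₚ.*-assoc (weightProd γ S) (halfPow ∣ S ∣) (fromℕ (N S))))))

Zcount-cong : ∀ {n} {M N : Subset n → ℕ} (γ : Fin n → ℚ) → (∀ S → M S ≡ N S) → Zcount M γ ≡ Zcount N γ
Zcount-cong {n} γ M≡N = ℚ∑.∑-cong n (λ S → cong (λ k → weightProd γ S * halfPow ∣ S ∣ * fromℕ k) (M≡N S))

Zcount-congʳ : ∀ {n} (N : Subset n → ℕ) {γ δ : Fin n → ℚ} → (∀ i → γ i ≡ δ i) → Zcount N γ ≡ Zcount N δ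
Zcount-congʳ {n} N γ≡δ =
  ℚ∑.∑-cong n (λ S → cong (λ w → w * halfPow ∣ S ∣ * fromℕ (N S)) (weightProd-cong γ≡δ S))

Zcount-+ : ∀ {n} (M N : Subset n → ℕ) (γ : Fin n → ℚ) →
           Zcount (λ S → M S ℕ.+ N S) γ ≡ Zcount M γ + Zcount N γ
Zcount-+ {n} M N γ = trans (ℚ∑.∑-cong n split) (ℚ∑.∑-distrib-+ n _ _)
  where
  split : ∀ S → Zterm (λ S → M S ℕ.+ N S) γ S ≡ Zterm M γ S + Zterm N γ S
  split S = trans (cong (weightProd γ S * halfPow ∣ S ∣ *_) (fromℕ-+ (M S) (N S)))
                  (ℚₚ.*-distribˡ-+ (weightProd γ S * halfPow ∣ S ∣) (fromℕ (M S)) (fromℕ (N S)))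

Zcount-nonneg : ∀ {n} (N : Subset n → ℕ) {γ : Fin n → ℚ} → NonNegWeights γ → 0ℚ ≤ Zcount N γ
Zcount-nonneg {n} N γ≥0 = ∑-nonneg n (Zterm N _) (Zterm-nonneg N γ≥0)

fromℕ-N⊥≤Zcount : ∀ {n} (N : Subset n → ℕ) {γ : Fin n → ℚ} → NonNegWeights γ → fromℕ (N ⊥) ≤ Zcount N γ
fromℕ-N⊥≤Zcount {n} N {γ} γ≥0 = subst (_≤ Zcount N γ) ⊥-term (f⊥≤∑ n (Zterm N γ) (Zterm-nonneg N γ≥0))
  where
  ⊥-term : Zterm N γ ⊥ ≡ fromℕ (N ⊥)
  ⊥-term = trans (cong₂ (λ w k → w * halfPow k * fromℕ (N ⊥)) (weightProd-⊥ γ) (∣⊥∣≡0 n)) (ℚₚ.*-identityˡ _)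

Zcount-++ : ∀ {n₁ n₂} (N : Subset (n₁ ℕ.+ n₂) → ℕ) (f₁ g₁ : Subset n₁ → ℕ) (f₂ g₂ : Subset n₂ → ℕ)
            (γ : Fin (n₁ ℕ.+ n₂) → ℚ) →
            (∀ S₁ S₂ → N (S₁ ++ S₂) ≡ f₁ S₁ ℕ.* f₂ S₂ ℕ.+ g₁ S₁ ℕ.* g₂ S₂) →
            Zcount N γ ≡ Zcount f₁ (γ ∘ (_↑ˡ n₂)) * Zcount f₂ (γ ∘ (n₁ ↑ʳ_))
                       + Zcount g₁ (γ ∘ (_↑ˡ n₂)) * Zcount g₂ (γ ∘ (n₁ ↑ʳ_))
Zcount-++ {n₁} {n₂} N f₁ g₁ f₂ g₂ γ N-++ = begin
  Zcount N γ
    ≡⟨ ℚ∑.∑-++ n₁ n₂ _ ⟩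
  ℚ∑.∑ n₁ (λ S₁ → ℚ∑.∑ n₂ (λ S₂ → Zterm N γ (S₁ ++ S₂)))
    ≡⟨ ℚ∑.∑-cong n₁ (λ S₁ → ℚ∑.∑-cong n₂ (λ S₂ → factor S₁ S₂)) ⟩
  ℚ∑.∑ n₁ (λ S₁ → ℚ∑.∑ n₂ (λ S₂ → Zterm f₁ γ₁ S₁ * Zterm f₂ γ₂ S₂ + Zterm g₁ γ₁ S₁ * Zterm g₂ γ₂ S₂))
    ≡⟨ ℚ∑.∑-cong n₁ (λ S₁ → ℚ∑.∑-distrib-+ n₂ _ _) ⟩
  ℚ∑.∑ n₁ (λ S₁ → ℚ∑.∑ n₂ (λ S₂ → Zterm f₁ γ₁ S₁ * Zterm f₂ γ₂ S₂) + ℚ∑.∑ n₂ (λ S₂ → Zterm g₁ γ₁ S₁ * Zterm g₂ γ₂ S₂))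
    ≡⟨ ℚ∑.∑-distrib-+ n₁ _ _ ⟩
  _ ≡⟨ cong₂ _+_ (ℚ∑.∑∑-* n₁ n₂ _ _) (ℚ∑.∑∑-* n₁ n₂ _ _) ⟩
  Zcount f₁ γ₁ * Zcount f₂ γ₂ + Zcount g₁ γ₁ * Zcount g₂ γ₂ ∎
  where
  open ≡-Reasoning
  γ₁ = γ ∘ (_↑ˡ n₂)
  γ₂ = γ ∘ (n₁ ↑ʳ_)
  factor : ∀ S₁ S₂ → Zterm N γ (S₁ ++ S₂) ≡ Zterm f₁ γ₁ S₁ * Zterm f₂ γ₂ S₂ + Zterm g₁ γ₁ S₁ * Zterm g₂ γ₂ S₂
  factor S₁ S₂
    rewrite weightProd-++ γ S₁ S₂ | ∣++∣ S₁ S₂ | halfPow-+ ∣ S₁ ∣ ∣ S₂ ∣ | N-++ S₁ S₂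
          | fromℕ-+ (f₁ S₁ ℕ.* f₂ S₂) (g₁ S₁ ℕ.* g₂ S₂) | fromℕ-* (f₁ S₁) (f₂ S₂) | fromℕ-* (g₁ S₁) (g₂ S₂)
    = regroup (weightProd γ₁ S₁) (weightProd γ₂ S₂) (halfPow ∣ S₁ ∣) (halfPow ∣ S₂ ∣)
              (fromℕ (f₁ S₁)) (fromℕ (f₂ S₂)) (fromℕ (g₁ S₁)) (fromℕ (g₂ S₂))
    where
    regroup : ∀ w₁ w₂ h₁ h₂ a₁ a₂ b₁ b₂ →
              w₁ * w₂ * (h₁ * h₂) * (a₁ * a₂ + b₁ * b₂)
                ≡ w₁ * h₁ * a₁ * (w₂ * h₂ * a₂) + w₁ * h₁ * b₁ * (w₂ * h₂ * b₂)
    regroup = solve-∀ ℚ-ring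

-- The partition function of a binary matroid and of its minors

halfPow-rank : ∀ {n} {c : Cycles n} → IsBinary c → ∀ S → halfPow (rank c S) ≡ halfPow ∣ S ∣ * fromℕ (cyclesIn c S)
halfPow-rank {c = c} bin S = begin
  hr                                  ≡⟨ sym (ℚₚ.*-identityʳ hr) ⟩
  hr * 1ℚ                             ≡⟨ cong (hr *_) (sym (halfPow*2^ ∣ S ∣)) ⟩
  hr * (hs * fromℕ (2 ℕ.^ ∣ S ∣))     ≡⟨ cong (λ k → hr * (hs * fromℕ k)) (sym (cyclesIn*2^rank bin S)) ⟩
  hr * (hs * fromℕ (N ℕ.* 2 ℕ.^ r))   ≡⟨ cong (λ q → hr * (hs * q)) (fromℕ-* N (2 ℕ.^ r)) ⟩
  hr * (hs * (fromℕ N * fromℕ (2 ℕ.^ r))) ≡⟨ regroup hr hs (fromℕ N) (fromℕ (2 ℕ.^ r)) ⟩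
  hs * fromℕ N * (hr * fromℕ (2 ℕ.^ r))   ≡⟨ cong (hs * fromℕ N *_) (halfPow*2^ r) ⟩
  hs * fromℕ N * 1ℚ                   ≡⟨ ℚₚ.*-identityʳ _ ⟩
  hs * fromℕ N                        ∎
  where
  open ≡-Reasoning
  r  = rank c S
  N  = cyclesIn c S
  hr = halfPow r
  hs = halfPow ∣ S ∣
  regroup : ∀ a b x y → a * (b * (x * y)) ≡ b * x * (a * y)
  regroup = solve-∀ ℚ-ring

2^-injective : ∀ {a b} → 2 ℕ.^ a ≡ 2 ℕ.^ b → a ≡ b
2^-injective 2^a≡2^b =
  ℕₚ.≤-antisym (2^-reflects-≤ (ℕₚ.≤-reflexive 2^a≡2^b)) (2^-reflects-≤ (ℕₚ.≤-reflexive (sym 2^a≡2^b)))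

rank-⁅p⁆ : ∀ {n} {c : Cycles (suc n)} → IsBinary c → c ⁅ zero ⁆ ≡ false → rank c ⁅ zero ⁆ ≡ 1
rank-⁅p⁆ {n} {c} bin nonloop = 2^-injective (begin
  2 ℕ.^ rank c ⁅ zero ⁆                         ≡⟨ ℕₚ.*-identityˡ _ ⟨
  1 ℕ.* 2 ℕ.^ rank c ⁅ zero ⁆                   ≡⟨ cong (ℕ._* 2 ℕ.^ rank c ⁅ zero ⁆) cyclesIn-⁅p⁆ ⟨
  cyclesIn c ⁅ zero ⁆ ℕ.* 2 ℕ.^ rank c ⁅ zero ⁆ ≡⟨ cyclesIn*2^rank bin ⁅ zero ⁆ ⟩
  2 ℕ.^ ∣ ⁅ zero {n} ⁆ ∣                         ≡⟨ cong (2 ℕ.^_) (∣⁅x⁆∣≡1 {n = suc n} zero) ⟩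
  2 ℕ.^ 1                                       ∎)
  where
  open ≡-Reasoning
  cyclesIn-⁅p⁆ : cyclesIn c ⁅ zero ⁆ ≡ 1
  cyclesIn-⁅p⁆ = trans (cong₂ ℕ._+_ (cyclesIn-⊥ (fiber false c)) (cyclesIn-⊥ (fiber true c)))
                       (cong₂ (λ a b → 𝟙 a ℕ.+ 𝟙 b) (empty-cycle bin) nonloop)

1≤rank[p∷S] : ∀ {n} {c : Cycles (suc n)} → c ⁅ zero ⁆ ≡ false → ∀ S → 1 ℕ.≤ rank c (true ∷ S)
1≤rank[p∷S] {n} {c} nonloop S = subst (ℕ._≤ rank c (true ∷ S)) (∣⁅x⁆∣≡1 {n = suc n} zero)
  (∣I∣≤rank c (⊥⊆ᵇ S) (independentᵇ⁺ c (Independent-⁅p⁆ nonloop)))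

Zfiber : ∀ {n} → Bool → Cycles (suc n) → (Fin (suc n) → ℚ) → ℚ
Zfiber b c γ = Zcount (cyclesIn (fiber b c)) (restrictW γ)

Ztilde≡Zcount : ∀ {n} {c : Cycles n} → IsBinary c → ∀ γ → Ztilde c γ ≡ Zcount (cyclesIn c) γ
Ztilde≡Zcount {c = c} bin γ = Zr≡Zcount (rank c) (cyclesIn c) γ (halfPow-rank bin)

Z-deletion : ∀ {n} {c : Cycles (suc n)} → IsBinary c → ∀ γ → Zr (delRank c) (restrictW γ) ≡ Zfiber false c γ
Z-deletion {c = c} bin γ = Zr≡Zcount (delRank c) (cyclesIn (fiber false c)) (restrictW γ) λ S →
  trans (halfPow-rank bin (false ∷ S)) (cong (λ N → halfPow ∣ S ∣ * fromℕ N) (cyclesIn-false∷ c S))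

Z-contraction : ∀ {n} {c : Cycles (suc n)} → IsBinary c → c ⁅ zero ⁆ ≡ false → ∀ γ →
                Zr (conRank c) (restrictW γ) ≡ Zfiber false c γ + Zfiber true c γ
Z-contraction {c = c} bin nonloop γ =
  trans (Zr≡Zcount (conRank c) (λ S → cyclesIn c (true ∷ S)) (restrictW γ) halfPow-conRank)
        (Zcount-+ (cyclesIn (fiber false c)) (cyclesIn (fiber true c)) (restrictW γ))
  where
  halfPow-conRank : ∀ S → halfPow (conRank c S) ≡ halfPow ∣ S ∣ * fromℕ (cyclesIn c (true ∷ S))
  halfPow-conRank S = begin
    halfPow (rank c (true ∷ S) ℕ.∸ rank c ⁅ zero ⁆)
      ≡⟨ cong (λ r → halfPow (rank c (true ∷ S) ℕ.∸ r)) (rank-⁅p⁆ bin nonloop) ⟩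
    halfPow (rank c (true ∷ S) ℕ.∸ 1)
      ≡⟨ halfPow-pred _ (1≤rank[p∷S] nonloop S) ⟩
    2ℚ * halfPow (rank c (true ∷ S))
      ≡⟨ cong (2ℚ *_) (halfPow-rank bin (true ∷ S)) ⟩
    2ℚ * (½ * halfPow ∣ S ∣ * fromℕ N)
      ≡⟨ ℚₚ.*-assoc 2ℚ (½ * halfPow ∣ S ∣) (fromℕ N) ⟨
    2ℚ * (½ * halfPow ∣ S ∣) * fromℕ N
      ≡⟨ cong (_* fromℕ N) (double-half (halfPow ∣ S ∣)) ⟩
    halfPow ∣ S ∣ * fromℕ N ∎
    where
    open ≡-Reasoning
    N = cyclesIn c (true ∷ S)

-- Delta-sums

deltaSum-++ : ∀ {n₁ n₂} (c₁ : Cycles (suc n₁)) (c₂ : Cycles (suc n₂)) S₁ S₂ →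
              deltaSum c₁ c₂ (S₁ ++ S₂) ≡ c₁ (false ∷ S₁) ∧ c₂ (false ∷ S₂) ∨ c₁ (true ∷ S₁) ∧ c₂ (true ∷ S₂)
deltaSum-++ {n₁} c₁ c₂ S₁ S₂ rewrite take-++ n₁ S₁ S₂ | drop-++ n₁ S₁ S₂ = refl

deltaSum-intro : ∀ {n₁ n₂} (c₁ : Cycles (suc n₁)) (c₂ : Cycles (suc n₂)) {S} b →
                 c₁ (b ∷ take n₁ S) ≡ true → c₂ (b ∷ drop n₁ S) ≡ true → deltaSum c₁ c₂ S ≡ true
deltaSum-intro c₁ c₂ false c₁[S₁] c₂[S₂] rewrite c₁[S₁] | c₂[S₂] = refl
deltaSum-intro c₁ c₂ true  c₁[S₁] c₂[S₂] rewrite c₁[S₁] | c₂[S₂] = ∨-zeroʳ _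

deltaSum-elim : ∀ {n₁ n₂} (c₁ : Cycles (suc n₁)) (c₂ : Cycles (suc n₂)) {S} → deltaSum c₁ c₂ S ≡ true →
                ∃ λ b → c₁ (b ∷ take n₁ S) ≡ true × c₂ (b ∷ drop n₁ S) ≡ true
deltaSum-elim {n₁} c₁ c₂ {S} Δ[S] with c₁ (false ∷ take n₁ S) in c₁[S₁] | c₂ (false ∷ drop n₁ S) in c₂[S₂]
... | true  | true  = false , c₁[S₁] , c₂[S₂]
... | true  | false = true , ∧-conicalˡ _ _ Δ[S] , ∧-conicalʳ _ _ Δ[S]
... | false | _     = true , ∧-conicalˡ _ _ Δ[S] , ∧-conicalʳ _ _ Δ[S]

deltaSum-binary : ∀ {n₁ n₂} {c₁ : Cycles (suc n₁)} {c₂ : Cycles (suc n₂)} →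
                  IsBinary c₁ → IsBinary c₂ → IsBinary (deltaSum c₁ c₂)
deltaSum-binary {n₁} {n₂} {c₁} {c₂} bin₁ bin₂ = record
  { empty-cycle = subst (λ X → deltaSum c₁ c₂ X ≡ true) (sym (⊥-++ n₁))
      (trans (deltaSum-++ c₁ c₂ ⊥ ⊥)
             (cong₂ (λ a b → a ∧ b ∨ c₁ (true ∷ ⊥) ∧ c₂ (true ∷ ⊥)) (empty-cycle bin₁) (empty-cycle bin₂)))
  ; ⊕-closed    = closed
  }
  where
  closed : ∀ A B → deltaSum c₁ c₂ A ≡ true → deltaSum c₁ c₂ B ≡ true → deltaSum c₁ c₂ (A ⊕ B) ≡ true
  closed A B Δ[A] Δ[B] with deltaSum-elim c₁ c₂ Δ[A] | deltaSum-elim c₁ c₂ Δ[B]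
  ... | a , c₁[A₁] , c₂[A₂] | b , c₁[B₁] , c₂[B₂] = deltaSum-intro c₁ c₂ (a xor b)
    (subst (λ X → c₁ ((a xor b) ∷ X) ≡ true) (sym (take-zipWith _xor_ A B))
           (⊕-closed bin₁ (a ∷ take n₁ A) (b ∷ take n₁ B) c₁[A₁] c₁[B₁]))
    (subst (λ X → c₂ ((a xor b) ∷ X) ≡ true) (sym (drop-zipWith _xor_ A B))
           (⊕-closed bin₂ (a ∷ drop n₁ A) (b ∷ drop n₁ B) c₂[A₂] c₂[B₂]))

𝟙-∧-∨-∧ : ∀ a b x y z w → x ∧ z ≡ false →
          𝟙 ((a ∧ b) ∧ (x ∧ y ∨ z ∧ w)) ≡ 𝟙 (a ∧ x) ℕ.* 𝟙 (b ∧ y) ℕ.+ 𝟙 (a ∧ z) ℕ.* 𝟙 (b ∧ w)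
𝟙-∧-∨-∧ false b     x     y     z     w     _ = refl
𝟙-∧-∨-∧ true  false false y     false w     _ = refl
𝟙-∧-∨-∧ true  false false y     true  w     _ = refl
𝟙-∧-∨-∧ true  false true  y     false w     _ = refl
𝟙-∧-∨-∧ true  true  false y     false w     _ = refl
𝟙-∧-∨-∧ true  true  false y     true  false _ = refl
𝟙-∧-∨-∧ true  true  false y     true  true  _ = refl
𝟙-∧-∨-∧ true  true  true  false false w     _ = refl
𝟙-∧-∨-∧ true  true  true  true  false w     _ = refl

cyclesIn-deltaSum-++ : ∀ {n₁ n₂} {c₁ : Cycles (suc n₁)} {c₂ : Cycles (suc n₂)} → IsBinary c₁ → c₁ ⁅ zero ⁆ ≡ false →
  ∀ S₁ S₂ → cyclesIn (deltaSum c₁ c₂) (S₁ ++ S₂)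
          ≡ cyclesIn (fiber false c₁) S₁ ℕ.* cyclesIn (fiber false c₂) S₂
            ℕ.+ cyclesIn (fiber true c₁) S₁ ℕ.* cyclesIn (fiber true c₂) S₂
cyclesIn-deltaSum-++ {n₁} {n₂} {c₁} {c₂} bin₁ nonloop₁ S₁ S₂ = begin
  cyclesIn (deltaSum c₁ c₂) (S₁ ++ S₂)
    ≡⟨ ℕ∑.∑-++ n₁ n₂ _ ⟩
  ℕ∑.∑ n₁ (λ T₁ → ℕ∑.∑ n₂ (λ T₂ → 𝟙 ((T₁ ++ T₂) ⊆ᵇ (S₁ ++ S₂) ∧ deltaSum c₁ c₂ (T₁ ++ T₂))))
    ≡⟨ ℕ∑.∑-cong n₁ (λ T₁ → ℕ∑.∑-cong n₂ (λ T₂ → factor T₁ T₂)) ⟩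
  ℕ∑.∑ n₁ (λ T₁ → ℕ∑.∑ n₂ (λ T₂ → in₁ false T₁ ℕ.* in₂ false T₂ ℕ.+ in₁ true T₁ ℕ.* in₂ true T₂))
    ≡⟨ ℕ∑.∑-cong n₁ (λ T₁ → ℕ∑.∑-distrib-+ n₂ _ _) ⟩
  ℕ∑.∑ n₁ (λ T₁ → ℕ∑.∑ n₂ (λ T₂ → in₁ false T₁ ℕ.* in₂ false T₂) ℕ.+ ℕ∑.∑ n₂ (λ T₂ → in₁ true T₁ ℕ.* in₂ true T₂))
    ≡⟨ ℕ∑.∑-distrib-+ n₁ _ _ ⟩
  _ ≡⟨ cong₂ ℕ._+_ (ℕ∑.∑∑-* n₁ n₂ _ _) (ℕ∑.∑∑-* n₁ n₂ _ _) ⟩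
  _ ∎
  where
  open ≡-Reasoning
  in₁ : Bool → Subset n₁ → ℕ
  in₁ b T₁ = 𝟙 (T₁ ⊆ᵇ S₁ ∧ c₁ (b ∷ T₁))
  in₂ : Bool → Subset n₂ → ℕ
  in₂ b T₂ = 𝟙 (T₂ ⊆ᵇ S₂ ∧ c₂ (b ∷ T₂))
  factor : ∀ T₁ T₂ → 𝟙 ((T₁ ++ T₂) ⊆ᵇ (S₁ ++ S₂) ∧ deltaSum c₁ c₂ (T₁ ++ T₂))
                   ≡ in₁ false T₁ ℕ.* in₂ false T₂ ℕ.+ in₁ true T₁ ℕ.* in₂ true T₂
  factor T₁ T₂ = trans (cong₂ (λ x y → 𝟙 (x ∧ y)) (⊆ᵇ-++ T₁ S₁ T₂ S₂) (deltaSum-++ c₁ c₂ T₁ T₂))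
                       (𝟙-∧-∨-∧ (T₁ ⊆ᵇ S₁) (T₂ ⊆ᵇ S₂) (c₁ (false ∷ T₁)) (c₂ (false ∷ T₂))
                                (c₁ (true ∷ T₁)) (c₂ (true ∷ T₂))
                                (fibers-disjoint bin₁ nonloop₁ T₁))

Z-deltaSum : ∀ {n₁ n₂} {c₁ : Cycles (suc n₁)} {c₂ : Cycles (suc n₂)} → IsBinary c₁ → IsBinary c₂ →
             c₁ ⁅ zero ⁆ ≡ false → ∀ γ₁ γ₂ →
             Ztilde (deltaSum c₁ c₂) (deltaW γ₁ γ₂)
               ≡ Zfiber false c₁ γ₁ * Zfiber false c₂ γ₂ + Zfiber true c₁ γ₁ * Zfiber true c₂ γ₂
Z-deltaSum {n₁} {n₂} {c₁} {c₂} bin₁ bin₂ nonloop₁ γ₁ γ₂ = begin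
  Ztilde (deltaSum c₁ c₂) γ
    ≡⟨ Ztilde≡Zcount (deltaSum-binary bin₁ bin₂) γ ⟩
  Zcount (cyclesIn (deltaSum c₁ c₂)) γ
    ≡⟨ Zcount-++ (cyclesIn (deltaSum c₁ c₂)) (N₁ false) (N₁ true) (N₂ false) (N₂ true) γ
                 (cyclesIn-deltaSum-++ {c₂ = c₂} bin₁ nonloop₁) ⟩
  Zcount (N₁ false) (γ ∘ (_↑ˡ n₂)) * Zcount (N₂ false) (γ ∘ (n₁ ↑ʳ_))
    + Zcount (N₁ true) (γ ∘ (_↑ˡ n₂)) * Zcount (N₂ true) (γ ∘ (n₁ ↑ʳ_))
    ≡⟨ cong₂ _+_ (cong₂ _*_ (Zcount-congʳ (N₁ false) γ-↑ˡ) (Zcount-congʳ (N₂ false) γ-↑ʳ))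
                 (cong₂ _*_ (Zcount-congʳ (N₁ true) γ-↑ˡ) (Zcount-congʳ (N₂ true) γ-↑ʳ)) ⟩
  Zfiber false c₁ γ₁ * Zfiber false c₂ γ₂ + Zfiber true c₁ γ₁ * Zfiber true c₂ γ₂ ∎
  where
  open ≡-Reasoning
  γ = deltaW γ₁ γ₂
  N₁ : Bool → Subset n₁ → ℕ
  N₁ b = cyclesIn (fiber b c₁)
  N₂ : Bool → Subset n₂ → ℕ
  N₂ b = cyclesIn (fiber b c₂)
  γ-↑ˡ : ∀ i → γ (i ↑ˡ n₂) ≡ restrictW γ₁ i
  γ-↑ˡ i = cong [ γ₁ ∘ suc , γ₂ ∘ suc ]′ (splitAt-↑ˡ n₁ i n₂)
  γ-↑ʳ : ∀ i → γ (n₁ ↑ʳ i) ≡ restrictW γ₂ i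
  γ-↑ʳ i = cong [ γ₁ ∘ suc , γ₂ ∘ suc ]′ (splitAt-↑ʳ n₁ n₂ i)

-- Replacing M₂ by I₂

I₂-binary : IsBinary I₂
I₂-binary = record { empty-cycle = refl ; ⊕-closed = closed }
  where
  closed : ∀ A B → I₂ A ≡ true → I₂ B ≡ true → I₂ (A ⊕ B) ≡ true
  closed (false ∷ false ∷ []) (false ∷ false ∷ []) _ _ = refl
  closed (false ∷ false ∷ []) (true ∷ true ∷ [])   _ _ = refl
  closed (true ∷ true ∷ [])   (false ∷ false ∷ []) _ _ = refl
  closed (true ∷ true ∷ [])   (true ∷ true ∷ [])   _ _ = refl
  closed (false ∷ true ∷ [])  _                    () _
  closed (true ∷ false ∷ [])  _                    () _
  closed (false ∷ false ∷ []) (false ∷ true ∷ [])  _ ()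
  closed (false ∷ false ∷ []) (true ∷ false ∷ [])  _ ()
  closed (true ∷ true ∷ [])   (false ∷ true ∷ [])  _ ()
  closed (true ∷ true ∷ [])   (true ∷ false ∷ [])  _ ()

Zfiber-false-I₂ : ∀ (δ : Fin 2 → ℚ) → Zfiber false I₂ δ ≡ 1ℚ + δ (suc zero) * ½
Zfiber-false-I₂ δ = simplify (δ (suc zero))
  where
  simplify : ∀ d → 1ℚ * 1ℚ * 1ℚ * fromℕ 1 + d * 1ℚ * (½ * 1ℚ) * fromℕ 1 ≡ 1ℚ + d * ½
  simplify = solve-∀ ℚ-ring

Zfiber-true-I₂ : ∀ (δ : Fin 2 → ℚ) → Zfiber true I₂ δ ≡ δ (suc zero) * ½
Zfiber-true-I₂ δ = simplify (δ (suc zero))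
  where
  simplify : ∀ d → 1ℚ * 1ℚ * 1ℚ * fromℕ 0 + d * 1ℚ * (½ * 1ℚ) * fromℕ 1 ≡ d * ½
  simplify = solve-∀ ℚ-ring

Zgap : ∀ {n} → Cycles (suc n) → (Fin (suc n) → ℚ) → ℚ
Zgap c γ = Zcount (λ S → cyclesIn (fiber false c) S ℕ.∸ cyclesIn (fiber true c) S) (restrictW γ)

Zfiber-false≡true+gap : ∀ {n} {c : Cycles (suc n)} → IsBinary c → ∀ γ → Zfiber false c γ ≡ Zfiber true c γ + Zgap c γ
Zfiber-false≡true+gap {c = c} bin γ = trans
  (Zcount-cong (restrictW γ) (λ S → sym (ℕₚ.m+[n∸m]≡n (cyclesIn-fiber-true≤false bin S))))
  (Zcount-+ (cyclesIn (fiber true c)) (λ S → cyclesIn (fiber false c) S ℕ.∸ cyclesIn (fiber true c) S) (restrictW γ))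

1≤Zgap : ∀ {n} {c : Cycles (suc n)} → IsBinary c → c ⁅ zero ⁆ ≡ false → ∀ {γ} → NonNegWeights γ → 1ℚ ≤ Zgap c γ
1≤Zgap {c = c} bin nonloop {γ} γ≥0 =
  subst (_≤ Zgap c γ) (cong fromℕ gap-at-⊥) (fromℕ-N⊥≤Zcount gap (γ≥0 ∘ suc))
  where
  gap : Subset _ → ℕ
  gap S = cyclesIn (fiber false c) S ℕ.∸ cyclesIn (fiber true c) S
  gap-at-⊥ : cyclesIn (fiber false c) ⊥ ℕ.∸ cyclesIn (fiber true c) ⊥ ≡ 1
  gap-at-⊥ = cong₂ ℕ._∸_ (trans (cyclesIn-⊥ (fiber false c)) (cong 𝟙 (empty-cycle bin)))
                         (trans (cyclesIn-⊥ (fiber true c)) (cong 𝟙 nonloop))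

-- inv 0 = 0 is a junk value that makes edgeWeight total.
inv : ℚ → ℚ
inv q with q ℚₚ.≟ 0ℚ
... | yes _   = 0ℚ
... | no q≢0 = (1/ q) {{ℚ.≢-nonZero q≢0}}

inv-inverseʳ : ∀ {q} → 0ℚ < q → q * inv q ≡ 1ℚ
inv-inverseʳ {q} 0<q with q ℚₚ.≟ 0ℚ
... | yes q≡0 = contradiction (sym q≡0) (ℚₚ.<⇒≢ 0<q)
... | no q≢0 = ℚₚ.*-inverseʳ q {{ℚ.≢-nonZero q≢0}}

inv-nonneg : ∀ {q} → 0ℚ < q → 0ℚ ≤ inv q
inv-nonneg {q} 0<q with q ℚₚ.≟ 0ℚ
... | yes _  = ℚₚ.≤-refl
... | no q≢0 = ℚₚ.<⇒≤ (ℚₚ.positive⁻¹ _ {{ℚₚ.1/pos⇒pos q {{ℚ.positive 0<q}}}})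

-- For x = Z̃(M \ p) = w + g and y = Z̃(M / p) = x + w, where w = Zfiber true and
-- g = Zgap, this is 2w/g.
edgeWeight : ℚ → ℚ → ℚ
edgeWeight x y = 2ℚ * (y - x) * inv (2ℚ * x - y)

edgeWeight-spec : ∀ {n} {c : Cycles (suc n)} → IsBinary c → c ⁅ zero ⁆ ≡ false → ∀ γ → NonNegWeights γ →
  let x = Zr (delRank c) (restrictW γ)
      d = edgeWeight x (Zr (conRank c) (restrictW γ))
  in 0ℚ ≤ d × (2ℚ + d) * Zfiber true c γ ≡ d * x
edgeWeight-spec {c = c} bin nonloop γ γ≥0 = d≥0 , balance
  where
  w = Zfiber true c γ
  g = Zgap c γ
  x = Zr (delRank c) (restrictW γ)
  d = edgeWeight x (Zr (conRank c) (restrictW γ))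
  0<g : 0ℚ < g
  0<g = ℚₚ.<-≤-trans (ℚₚ.positive⁻¹ 1ℚ) (1≤Zgap bin nonloop γ≥0)
  x≡w+g : x ≡ w + g
  x≡w+g = trans (Z-deletion bin γ) (Zfiber-false≡true+gap bin γ)
  y≡x+w : Zr (conRank c) (restrictW γ) ≡ (w + g) + w
  y≡x+w = trans (Z-contraction bin nonloop γ) (cong (_+ w) (Zfiber-false≡true+gap bin γ))
  d≡2w/g : d ≡ 2ℚ * w * inv g
  d≡2w/g = trans (cong₂ edgeWeight x≡w+g y≡x+w)
                 (cong₂ (λ a b → 2ℚ * a * inv b) (simplify-y-x w g) (simplify-2x-y w g))
    where
    simplify-y-x : ∀ w g → (w + g) + w - (w + g) ≡ w
    simplify-y-x = solve-∀ ℚ-ring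
    simplify-2x-y : ∀ w g → 2ℚ * (w + g) - ((w + g) + w) ≡ g
    simplify-2x-y = solve-∀ ℚ-ring
  d≥0 : 0ℚ ≤ d
  d≥0 = subst (0ℚ ≤_) (sym d≡2w/g)
    (*-nonneg (*-nonneg (ℚₚ.<⇒≤ (ℚₚ.positive⁻¹ 2ℚ)) (Zcount-nonneg (cyclesIn (fiber true c)) (γ≥0 ∘ suc)))
              (inv-nonneg 0<g))
  balance : (2ℚ + d) * w ≡ d * x
  balance = begin
    (2ℚ + d) * w                              ≡⟨ cong (λ t → (2ℚ + t) * w) d≡2w/g ⟩
    (2ℚ + 2ℚ * w * inv g) * w                 ≡⟨ expand w (inv g) ⟩
    2ℚ * w * inv g * w + 2ℚ * w * 1ℚ          ≡⟨ cong (λ t → 2ℚ * w * inv g * w + 2ℚ * w * t) (inv-inverseʳ 0<g) ⟨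
    2ℚ * w * inv g * w + 2ℚ * w * (g * inv g) ≡⟨ factor w g (inv g) ⟩
    2ℚ * w * inv g * (w + g)                  ≡⟨ cong₂ _*_ d≡2w/g x≡w+g ⟨
    d * x                                     ∎
    where
    open ≡-Reasoning
    expand : ∀ w v → (2ℚ + 2ℚ * w * v) * w ≡ 2ℚ * w * v * w + 2ℚ * w * 1ℚ
    expand = solve-∀ ℚ-ring
    factor : ∀ w g v → 2ℚ * w * v * w + 2ℚ * w * (g * v) ≡ 2ℚ * w * v * (w + g)
    factor = solve-∀ ℚ-ring

lambda-identity : ∀ d (d≥0 : 0ℚ ≤ d) x w P⁰ P¹ → (2ℚ + d) * w ≡ d * x →
                  P⁰ * x + P¹ * w ≡ lambda d d≥0 x * (P⁰ * (1ℚ + d * ½) + P¹ * (d * ½))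
lambda-identity d d≥0 x w P⁰ P¹ balance = sym (begin
  2ℚ * u * x * (P⁰ * (1ℚ + d * ½) + P¹ * (d * ½))   ≡⟨ expand u x P⁰ P¹ d ⟩
  P⁰ * x * ((2ℚ + d) * u) + P¹ * u * (d * x)         ≡⟨ cong (λ t → P⁰ * x * ((2ℚ + d) * u) + P¹ * u * t) balance ⟨
  P⁰ * x * ((2ℚ + d) * u) + P¹ * u * ((2ℚ + d) * w) ≡⟨ factor P⁰ P¹ x w (2ℚ + d) u ⟩
  (P⁰ * x + P¹ * w) * ((2ℚ + d) * u)                 ≡⟨ cong ((P⁰ * x + P¹ * w) *_) (ℚₚ.*-inverseʳ (2ℚ + d)) ⟩
  (P⁰ * x + P¹ * w) * 1ℚ                             ≡⟨ ℚₚ.*-identityʳ _ ⟩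
  P⁰ * x + P¹ * w                                    ∎)
  where
  open ≡-Reasoning
  instance
    2+d≢0 : ℚ.NonZero (2ℚ + d)
    2+d≢0 = ℚ.>-nonZero (2+d>0 d d≥0)
  u = 1/ (2ℚ + d)
  expand : ∀ u x P⁰ P¹ d → 2ℚ * u * x * (P⁰ * (1ℚ + d * ½) + P¹ * (d * ½))
                         ≡ P⁰ * x * ((2ℚ + d) * u) + P¹ * u * (d * x)
  expand = solve-∀ ℚ-ring
  factor : ∀ P⁰ P¹ x w e u → P⁰ * x * (e * u) + P¹ * u * (e * w) ≡ (P⁰ * x + P¹ * w) * (e * u)
  factor = solve-∀ ℚ-ring

Z-deltaSum-by-I₂ : ∀ {n₁ n₂} {c₁ : Cycles (suc n₁)} {c₂ : Cycles (suc n₂)} → IsBinary c₁ → IsBinary c₂ →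
  c₁ ⁅ zero ⁆ ≡ false → ∀ γ₁ γ₂ {d} (d≥0 : 0ℚ ≤ d) →
  (2ℚ + d) * Zfiber true c₂ γ₂ ≡ d * Zr (delRank c₂) (restrictW γ₂) →
  ∀ (δ : Fin 2 → ℚ) → δ (suc zero) ≡ d →
  Ztilde (deltaSum c₁ c₂) (deltaW γ₁ γ₂)
    ≡ lambda d d≥0 (Zr (delRank c₂) (restrictW γ₂)) * Ztilde (deltaSum c₁ I₂) (deltaW γ₁ δ)
Z-deltaSum-by-I₂ {c₁ = c₁} {c₂} bin₁ bin₂ nonloop₁ γ₁ γ₂ {d} d≥0 balance δ δₑ≡d = begin
  Ztilde (deltaSum c₁ c₂) (deltaW γ₁ γ₂)           ≡⟨ Z-deltaSum bin₁ bin₂ nonloop₁ γ₁ γ₂ ⟩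
  P⁰ * Zfiber false c₂ γ₂ + P¹ * w                 ≡⟨ cong (λ z → P⁰ * z + P¹ * w) (Z-deletion bin₂ γ₂) ⟨
  P⁰ * x + P¹ * w                                  ≡⟨ lambda-identity d d≥0 x w P⁰ P¹ balance ⟩
  lambda d d≥0 x * (P⁰ * (1ℚ + d * ½) + P¹ * (d * ½)) ≡⟨ cong (lambda d d≥0 x *_) Z-I₂ ⟨
  lambda d d≥0 x * Ztilde (deltaSum c₁ I₂) (deltaW γ₁ δ) ∎
  where
  open ≡-Reasoning
  P⁰ = Zfiber false c₁ γ₁
  P¹ = Zfiber true c₁ γ₁
  w  = Zfiber true c₂ γ₂
  x  = Zr (delRank c₂) (restrictW γ₂)
  Z-I₂ : Ztilde (deltaSum c₁ I₂) (deltaW γ₁ δ) ≡ P⁰ * (1ℚ + d * ½) + P¹ * (d * ½)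
  Z-I₂ = trans (Z-deltaSum bin₁ I₂-binary nonloop₁ γ₁ δ)
    (cong₂ (λ a b → P⁰ * a + P¹ * b) (trans (Zfiber-false-I₂ δ) (cong (λ e → 1ℚ + e * ½) δₑ≡d))
                                     (trans (Zfiber-true-I₂ δ) (cong (_* ½) δₑ≡d)))

corollary7 : Σ (ℚ → ℚ → ℚ) λ D →
    ∀ {n₁ n₂ : ℕ} (c₁ : Cycles (suc n₁)) (c₂ : Cycles (suc n₂)) →
    IsBinary c₁ → IsBinary c₂ →
    c₁ ⁅ zero ⁆ ≡ false → c₂ ⁅ zero ⁆ ≡ false →
    (γ₁ : Fin (suc n₁) → ℚ) (γ₂ : Fin (suc n₂) → ℚ) →
    NonNegWeights γ₁ → NonNegWeights γ₂ →
    Σ (0ℚ ≤ D (Zr (delRank c₂) (restrictW γ₂)) (Zr (conRank c₂) (restrictW γ₂))) λ d≥0 →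
      (δ : Fin 2 → ℚ) → NonNegWeights δ →
      δ (suc zero) ≡ D (Zr (delRank c₂) (restrictW γ₂)) (Zr (conRank c₂) (restrictW γ₂)) →
      Ztilde (deltaSum c₁ c₂) (deltaW γ₁ γ₂)
        ≡ lambda (D (Zr (delRank c₂) (restrictW γ₂)) (Zr (conRank c₂) (restrictW γ₂))) d≥0
                 (Zr (delRank c₂) (restrictW γ₂))
          * Ztilde (deltaSum c₁ I₂) (deltaW γ₁ δ)
-- Nonnegativity is used only for γ₂, where it gives d ≥ 0 so that λ is defined.
corollary7 = edgeWeight , λ c₁ c₂ bin₁ bin₂ nonloop₁ nonloop₂ γ₁ γ₂ _ γ₂≥0 →
  let d≥0 , balance = edgeWeight-spec bin₂ nonloop₂ γ₂ γ₂≥0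
  in d≥0 , λ δ _ → Z-deltaSum-by-I₂ bin₁ bin₂ nonloop₁ γ₁ γ₂ d≥0 balance δ
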